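{- Let $P$ be a finite nonempty partially ordered set satisfying: 1. for every $x\in P$, all inextensible chains ascending from $x$ have the same length; 2. for all maximal elements $x\in P$, the maximal length of a chain descending from $x$ is independent of $x$. Let $m$ be the maximal length of a chain in $P$. Then a strictly monotone function $\gamma:P\to\mathbb{N}\setminus\{0\}$ is minimal (with respect to $\le_{\mathrm{M}(P)}$) in $\operatorname{int}(\mathrm{C}(P))\cap\mathrm{M}(P)$ if and only if $\gamma(x_i)=i$ for every chain $x_1<\dots<x_m$ of maximal length.
   Context: The length of a chain is its number of elements. $\mathrm{M}(P)$ is the monoid of monotone functions $P\to\mathbb{N}$ under pointwise addition; $f\le_{\mathrm{M}(P)}g$ means $g-f\in\mathrm{M}(P)$. $\mathrm{C}(P)\subseteq\mathbb{Q}^P$ is the cone of nonnegative monotone rational functions, defined by $f(x)\ge0$ for minimal $x$ and $f(x)\le f(y)$ for covers $y$ of $x$; its interior is given by the corresponding strict inequalities, so $\operatorname{int}(\mathrm{C}(P))\cap\mathrm{M}(P)$ consists of the strictly monotone functions $P\to\mathbb{N}\setminus\{0\}$. -}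

module Defs where

open import Data.Nat using (ℕ; zero; suc) renaming (_≤_ to _≤ℕ_; _<_ to _<ℕ_)
open import Data.Nat using (_∸_)
open import Data.Fin using (Fin; toℕ)
open import Data.List using (List; []; _∷_; length; lookup; head; last)
open import Data.List.Relation.Unary.Linked using (Linked)
open import Data.List.Relation.Binary.Sublist.Propositional using (_⊆_)
open import Data.Maybe using (just)
open import Data.Product using (Σ; _×_; ∃)
open import Relation.Binary.PropositionalEquality using (_≡_; _≢_)
open import Relation.Nullary using (¬_)

module _ {n : ℕ} (_≤_ : Fin n → Fin n → Set) where

  Lt : Fin n → Fin n → Set
  Lt x y = (x ≤ y) × (x ≢ y)

  -- a chain x₁ < x₂ < … < x_k, listed in increasing order; its length is the number of elements
  IsChain : List (Fin n) → Set
  IsChain c = Linked Lt c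

  AscFrom : Fin n → List (Fin n) → Set
  AscFrom x c = IsChain c × head c ≡ just x

  DescFrom : Fin n → List (Fin n) → Set
  DescFrom x c = IsChain c × last c ≡ just x

  InextensibleAscFrom : Fin n → List (Fin n) → Set
  InextensibleAscFrom x c =
    AscFrom x c × (∀ c' → AscFrom x c' → c ⊆ c' → length c' ≤ℕ length c)

  IsMaxLength : (List (Fin n) → Set) → ℕ → Set
  IsMaxLength S k = (Σ (List (Fin n)) λ c → S c × length c ≡ k) × (∀ c → S c → length c ≤ℕ k)

  IsMaximal : Fin n → Set
  IsMaximal x = ∀ y → x ≤ y → x ≡ y

  Hyp1 : Set
  Hyp1 = ∀ x c d → InextensibleAscFrom x c → InextensibleAscFrom x d → length c ≡ length d

  Hyp2 : Set
  Hyp2 = ∀ x y k l → IsMaximal x → IsMaximal y →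
         IsMaxLength (DescFrom x) k → IsMaxLength (DescFrom y) l → k ≡ l

  InM : (Fin n → ℕ) → Set
  InM f = ∀ x y → x ≤ y → f x ≤ℕ f y

  -- int(C(P)) ∩ M(P): strictly monotone functions P → ℕ ∖ {0}
  InIntCM : (Fin n → ℕ) → Set
  InIntCM f = (∀ x → 0 <ℕ f x) × (∀ x y → Lt x y → f x <ℕ f y)

  -- f ≤_M(P) g  iff  g - f ∈ M(P)  (g - f taken in ℤ; it must be ℕ-valued, i.e. f ≤ g pointwise)
  LeM : (Fin n → ℕ) → (Fin n → ℕ) → Set
  LeM f g = (∀ x → f x ≤ℕ g x) × InM (λ x → g x ∸ f x)

  MinimalInIntCM : (Fin n → ℕ) → Set
  MinimalInIntCM γ = InIntCM γ × (∀ δ → InIntCM δ → LeM δ γ → ∀ x → δ x ≡ γ x)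

-- A strictly monotone positive γ satisfies γ(x_i) ≥ i along every chain x_1 < … < x_k, so the
-- labelling condition says γ is as small as possible on the longest chains.  If γ is minimal, compare
-- it with δ = γ ⊓ (m + 1 − height), where height x is the length of a longest chain ascending
-- from x.  Hypothesis 1 makes γ + height monotone (every inextensible chain from x through y
-- has length height x), so γ − δ is monotone, minimality forces δ = γ, and along a chain of
-- length m this gives γ(x_i) ≤ i.  Conversely, if γ labels the longest chains by 1, …, m,
-- every x lies below the top z of a longest chain ascending from x; z is maximal, so by
-- hypothesis 2 some chain of length m ends in z, whence γ z = m ≤ δ z for any strictly
-- monotone δ ≤_M γ, and monotonicity of γ − δ gives γ x ≤ δ x.
-- Since _≤_ is not assumed decidable, longest chains exist only up to double negation; this
-- suffices because all conclusions are decidable statements about natural numbers.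
module Submission where

open import Defs
open import Data.Nat using (ℕ; zero; suc; _<_; _+_; _∸_; _⊓_; _⊔_; _≤?_; _≟_; z<s) renaming (_≤_ to _≤ℕ_)
open import Data.Nat.Properties
open import Data.Fin using (Fin; toℕ) renaming (zero to fzero; suc to fsuc)
import Data.Fin.Properties as Fin
open import Data.List using (List; []; _∷_; [_]; _∷ʳ_; length; lookup; head; last; _++_; drop)
open import Data.List.Properties using (length-drop; length-++)
open import Data.List.Membership.Propositional using (_∈_)
open import Data.List.Membership.Propositional.Properties using (∈-∃++)
open import Data.List.Relation.Unary.Any using (here; there)
open import Data.List.Relation.Unary.Linked using (Linked; []; [-]; _∷_)
import Data.List.Relation.Unary.Linked as Linked
open import Data.List.Relation.Unary.Linked.Properties using (++⁺)
open import Data.List.Relation.Binary.Sublist.Propositional.Properties using (Any-resp-⊆)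
open import Data.Maybe using (just)
open import Data.Maybe.Relation.Binary.Connected using (Connected; just)
open import Data.Product using (∃; ∃₂; _×_; _,_; proj₁; proj₂)
open import Data.Empty using (⊥-elim)
open import Level using (Level)
open import Relation.Binary.PropositionalEquality using (_≡_; refl; sym; trans; cong; subst; subst₂; module ≡-Reasoning)
open import Relation.Binary.Structures using (IsPartialOrder)
open import Relation.Nullary using (¬_; yes; no)
open import Relation.Nullary.Decidable using (decidable-stable)
open import Function.Bundles using (_⇔_; mk⇔)

private variable
  a p r : Level
  A : Set a

Longest : (List A → Set p) → List A → Set _
Longest S c = S c × (∀ d → S d → length d ≤ℕ length c)

¬¬-longest : {S : List A → Set p} (B : ℕ) → (∀ c → S c → length c ≤ℕ B) →
             ∀ {c} → S c → ¬ ¬ ∃ (Longest S)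
¬¬-longest {S = S} B bounded {c} s = search (B ∸ length c) s (m≤n+m∸n B (length c))
  where
  search : ∀ k {c} → S c → B ≤ℕ length c + k → ¬ ¬ ∃ (Longest S)
  search zero {c} s B≤c ¬longest =
    ¬longest (c , s , λ d sd → ≤-trans (bounded d sd) (≤-trans B≤c (≤-reflexive (+-identityʳ _))))
  search (suc k) {c} s B≤c+1+k ¬longest = ¬longest (c , s , longest)
    where
    longest : ∀ d → S d → length d ≤ℕ length c
    longest d sd with length d ≤? length c
    ... | yes d≤c = d≤c
    ... | no d≰c = ⊥-elim (search k sd B≤d+k ¬longest)
      where
      B≤d+k : B ≤ℕ length d + k
      B≤d+k = ≤-trans B≤c+1+k (≤-trans (≤-reflexive (+-suc (length c) k)) (+-monoˡ-≤ k (≰⇒> d≰c)))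

¬¬-∀-Fin : ∀ {n} {P : Fin n → Set p} → (∀ i → ¬ ¬ P i) → ¬ ¬ (∀ i → P i)
¬¬-∀-Fin {n = zero} _ ¬all = ¬all λ ()
¬¬-∀-Fin {n = suc n} ¬¬P ¬all = ¬¬P fzero λ P0 → ¬¬-∀-Fin (λ i → ¬¬P (fsuc i)) λ Psuc →
  ¬all λ { fzero → P0 ; (fsuc i) → Psuc i }

last-∷ : (x : A) (xs : List A) → ∃ λ z → last (x ∷ xs) ≡ just z
last-∷ x [] = x , refl
last-∷ x (y ∷ xs) = last-∷ y xs

lookup-last : (xs : List A) {z : A} → last xs ≡ just z → ∃ λ i → lookup xs i ≡ z
lookup-last (x ∷ []) refl = fzero , refl
lookup-last (x ∷ y ∷ xs) eq with lookup-last (y ∷ xs) eq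
... | i , lookup≡z = fsuc i , lookup≡z

head-drop : (xs : List A) (i : Fin (length xs)) → head (drop (toℕ i) xs) ≡ just (lookup xs i)
head-drop (x ∷ xs) fzero = refl
head-drop (x ∷ xs) (fsuc i) = head-drop xs i

module _ {R : A → A → Set r} where

  Linked-∷ʳ : ∀ {xs y z} → Linked R xs → last xs ≡ just z → R z y → Linked R (xs ∷ʳ y)
  Linked-∷ʳ {y = y} ch last≡z Rzy =
    ++⁺ ch (subst (λ l → Connected R l (just y)) (sym last≡z) (just Rzy)) [-]

  Linked-drop : ∀ k {xs} → Linked R xs → Linked R (drop k xs)
  Linked-drop zero ch = ch
  Linked-drop (suc k) [] = []
  Linked-drop (suc k) {_ ∷ _} ch = Linked-drop k (Linked.tail ch)

  Linked-suffix : ∀ {x y} as {bs} → Linked R (x ∷ as ++ y ∷ bs) → Linked R (y ∷ bs)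
  Linked-suffix [] (_ ∷ ch) = ch
  Linked-suffix (_ ∷ as) (_ ∷ ch) = Linked-suffix as ch

  module _ (f : A → ℕ) (f-strict : ∀ {x y} → R x y → f x < f y) where

    lookup-≥-head : ∀ {x xs} → Linked R (x ∷ xs) → (i : Fin (length (x ∷ xs))) →
                    f x + toℕ i ≤ℕ f (lookup (x ∷ xs) i)
    lookup-≥-head _ fzero = ≤-reflexive (+-identityʳ _)
    lookup-≥-head {x} (Rxy ∷ ch) (fsuc i) = begin
      f x + suc (toℕ i) ≡⟨ +-suc (f x) (toℕ i) ⟩
      suc (f x) + toℕ i ≤⟨ +-monoˡ-≤ (toℕ i) (f-strict Rxy) ⟩
      _ + toℕ i         ≤⟨ lookup-≥-head ch i ⟩
      _                 ∎
      where open ≤-Reasoning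

    element-≥-head : ∀ {x y} as {bs} → Linked R (x ∷ as ++ y ∷ bs) → f x + length (x ∷ as) ≤ℕ f y
    element-≥-head {x} [] (Rxy ∷ _) = ≤-trans (≤-reflexive (+-comm (f x) 1)) (f-strict Rxy)
    element-≥-head {x} (z ∷ as) (Rxz ∷ ch) = begin
      f x + suc (suc (length as)) ≡⟨ +-suc (f x) _ ⟩
      suc (f x) + suc (length as) ≤⟨ +-monoˡ-≤ _ (f-strict Rxz) ⟩
      f z + suc (length as)       ≤⟨ element-≥-head as ch ⟩
      _                           ∎
      where open ≤-Reasoning

∸-∸≡+-∸ : ∀ k {h M} → h ≤ℕ M → k ∸ (M ∸ h) ≡ k + h ∸ M
∸-∸≡+-∸ k {h} {M} h≤M = begin
  k ∸ (M ∸ h)           ≡⟨ cong (_∸ (M ∸ h)) (m+n∸n≡m k h) ⟨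
  k + h ∸ h ∸ (M ∸ h)   ≡⟨ ∸-+-assoc (k + h) h (M ∸ h) ⟩
  k + h ∸ (h + (M ∸ h)) ≡⟨ cong (k + h ∸_) (m+[n∸m]≡n h≤M) ⟩
  k + h ∸ M             ∎
  where open ≡-Reasoning

module _ {n : ℕ} (_≤_ : Fin n → Fin n → Set) where

  private
    _≺_ : Fin n → Fin n → Set
    _≺_ = Lt _≤_

  InM-from-≺ : (g : Fin n → ℕ) → (∀ {x y} → x ≺ y → g x ≤ℕ g y) → InM _≤_ g
  InM-from-≺ g g-mono x y x≤y with x Fin.≟ y
  ... | yes refl = ≤-refl
  ... | no x≢y = g-mono (x≤y , x≢y)

  InIntCM⇒label≤ : ∀ {f} → InIntCM _≤_ f → ∀ {c} → IsChain _≤_ c → (i : Fin (length c)) →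
                   suc (toℕ i) ≤ℕ f (lookup c i)
  InIntCM⇒label≤ {f} (f-pos , f-strict) {x ∷ _} ch i =
    ≤-trans (+-monoˡ-≤ (toℕ i) (f-pos x)) (lookup-≥-head f (f-strict _ _) ch i)

  MinimalInIntCM⇒≤ : ∀ {γ ρ} → MinimalInIntCM _≤_ γ → InIntCM _≤_ ρ →
                     InM _≤_ (λ x → γ x ∸ ρ x) → ∀ x → γ x ≤ℕ ρ x
  MinimalInIntCM⇒≤ {γ} {ρ} ((γ-pos , γ-strict) , γ-minimal) (ρ-pos , ρ-strict) γ∸ρ-mono x =
    subst (_≤ℕ ρ x) (γ-minimal δ δ-int δ≤γ x) (m⊓n≤n (γ x) (ρ x))
    where
    δ : Fin n → ℕ
    δ x = γ x ⊓ ρ x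
    δ-int : InIntCM _≤_ δ
    δ-int = (λ x → ⊓-pres-m< (γ-pos x) (ρ-pos x)) ,
            (λ x y x≺y → ⊓-mono-< (γ-strict x y x≺y) (ρ-strict x y x≺y))
    γ∸δ≡γ∸ρ : ∀ x → γ x ∸ δ x ≡ γ x ∸ ρ x
    γ∸δ≡γ∸ρ x = trans (∸-distribˡ-⊓-⊔ (γ x) (γ x) (ρ x)) (cong (_⊔ (γ x ∸ ρ x)) (n∸n≡0 (γ x)))
    δ≤γ : LeM _≤_ δ γ
    δ≤γ = (λ x → m⊓n≤m (γ x) (ρ x)) ,
          (λ x y x≤y → subst₂ _≤ℕ_ (sym (γ∸δ≡γ∸ρ x)) (sym (γ∸δ≡γ∸ρ y)) (γ∸ρ-mono x y x≤y))

  LeM-agrees-below : ∀ {δ γ x z} → LeM _≤_ δ γ → x ≤ z → γ z ≤ℕ δ z → δ x ≡ γ x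
  LeM-agrees-below {δ} {γ} {x} {z} (δ≤γ , γ∸δ-mono) x≤z γz≤δz =
    ≤-antisym (δ≤γ x) (m∸n≡0⇒m≤n γx∸δx≡0)
    where
    γx∸δx≡0 : γ x ∸ δ x ≡ 0
    γx∸δx≡0 = n≤0⇒n≡0 (subst (γ x ∸ δ x ≤ℕ_) (m≤n⇒m∸n≡0 γz≤δz) (γ∸δ-mono x z x≤z))

  last-isMaximal : ∀ {c z} → IsChain _≤_ c → last c ≡ just z →
                   (∀ y → IsChain _≤_ (c ∷ʳ y) → length (c ∷ʳ y) ≤ℕ length c) → IsMaximal _≤_ z
  last-isMaximal {c} {z} ch last≡z longest y z≤y with z Fin.≟ y
  ... | yes z≡y = z≡y
  ... | no z≢y = ⊥-elim (m+1+n≰m (length c) (subst (_≤ℕ length c) (length-++ c) c∷ʳy≤c))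
    where
    c∷ʳy≤c : length (c ∷ʳ y) ≤ℕ length c
    c∷ʳy≤c = longest y (Linked-∷ʳ ch last≡z (z≤y , z≢y))

  module _ (isPartialOrder : IsPartialOrder _≡_ _≤_) (m : ℕ)
           (bounded : ∀ c → IsChain _≤_ c → length c ≤ℕ m) where

    private module P = IsPartialOrder isPartialOrder

    head≤last : ∀ {c x z} → IsChain _≤_ c → head c ≡ just x → last c ≡ just z → x ≤ z
    head≤last [-] refl refl = P.reflexive refl
    head≤last (x≺y ∷ ch) refl last≡z = P.trans (proj₁ x≺y) (head≤last ch refl last≡z)

    longest⇒inextensible : ∀ {x c} → Longest (AscFrom _≤_ x) c → InextensibleAscFrom _≤_ x c
    longest⇒inextensible (asc , longest) = asc , λ d asc′ _ → longest d asc′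

    ¬¬-longest-AscFrom : ∀ x → ¬ ¬ ∃ (Longest (AscFrom _≤_ x))
    ¬¬-longest-AscFrom x = ¬¬-longest m (λ c asc → bounded c (proj₁ asc)) {[ x ]} ([-] , refl)

    module Heights (heights : ∀ x → ∃ (Longest (AscFrom _≤_ x))) where

      height : Fin n → ℕ
      height x = length (proj₁ (heights x))

      height≤m : ∀ x → height x ≤ℕ m
      height≤m x = bounded _ (proj₁ (proj₁ (proj₂ (heights x))))

      height-≤ : ∀ {x c} → AscFrom _≤_ x c → length c ≤ℕ height x
      height-≤ {x} = proj₂ (proj₂ (heights x)) _

      height-anti : ∀ {x y} → x ≺ y → height y < height x
      height-anti {y = y} x≺y with heights y
      ... | _ ∷ _ , ((ch , refl) , _) = height-≤ (x≺y ∷ ch , refl)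

      lookup-height : ∀ {c} → IsChain _≤_ c → (i : Fin (length c)) →
                      length c ∸ toℕ i ≤ℕ height (lookup c i)
      lookup-height {c} ch i = subst (_≤ℕ height (lookup c i)) (length-drop (toℕ i) c)
                                     (height-≤ (Linked-drop (toℕ i) ch , head-drop c i))

      ¬¬-height-through : Hyp1 _≤_ → ∀ {x y} → x ≺ y →
        ¬ ¬ ∃₂ λ as bs → IsChain _≤_ (x ∷ as ++ y ∷ bs) × length (x ∷ as ++ y ∷ bs) ≡ height x
      ¬¬-height-through hyp1 {x} {y} x≺y ¬through =
        ¬¬-longest m (λ c asc → bounded c (proj₁ (proj₁ asc))) {x ∷ [ y ]}
          ((x≺y ∷ [-] , refl) , there (here refl)) through
        where
        Through : List (Fin n) → Set
        Through c = AscFrom _≤_ x c × y ∈ c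
        through : ¬ ∃ (Longest Through)
        through (_ ∷ t , ((ch , refl) , y∈c) , longest) with y∈c
        ... | here y≡x = proj₂ x≺y (sym y≡x)
        ... | there y∈t with ∈-∃++ y∈t
        ...   | as , bs , refl =
          ¬through (as , bs , ch , hyp1 x _ _ inextensible (longest⇒inextensible (proj₂ (heights x))))
          where
          inextensible : InextensibleAscFrom _≤_ x (x ∷ as ++ y ∷ bs)
          inextensible = (ch , refl) , λ d asc sub → longest d (asc , Any-resp-⊆ sub y∈c)

      γ+height-mono : Hyp1 _≤_ → ∀ {γ} → (∀ x y → x ≺ y → γ x < γ y) →
                      ∀ {x y} → x ≺ y → γ x + height x ≤ℕ γ y + height y
      γ+height-mono hyp1 {γ} γ-strict {x} {y} x≺y =
        decidable-stable (_ ≤? _) λ ≰ → ¬¬-height-through hyp1 x≺y λ (as , bs , ch , len) → ≰ (begin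
          γ x + height x                               ≡⟨ cong (γ x +_) len ⟨
          γ x + suc (length (as ++ y ∷ bs))            ≡⟨ cong (λ l → γ x + suc l) (length-++ as) ⟩
          γ x + (length (x ∷ as) + length (y ∷ bs))    ≡⟨ +-assoc (γ x) _ _ ⟨
          γ x + length (x ∷ as) + length (y ∷ bs)      ≤⟨ +-mono-≤ (element-≥-head γ (γ-strict _ _) as ch)
                                                                   (height-≤ (Linked-suffix as ch , refl)) ⟩
          γ y + height y                               ∎)
        where open ≤-Reasoning

      coheight : Fin n → ℕ
      coheight x = suc m ∸ height x

      coheight-InIntCM : InIntCM _≤_ coheight
      coheight-InIntCM =
        (λ x → subst (0 <_) (sym (+-∸-assoc 1 (height≤m x))) z<s) ,
        (λ x y x≺y → ∸-monoʳ-< (height-anti x≺y) (m≤n⇒m≤1+n (height≤m x)))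

      γ∸coheight-mono : Hyp1 _≤_ → ∀ {γ} → InIntCM _≤_ γ → InM _≤_ (λ x → γ x ∸ coheight x)
      γ∸coheight-mono hyp1 {γ} (_ , γ-strict) = InM-from-≺ _ λ {x} {y} x≺y → begin
        γ x ∸ coheight x       ≡⟨ ∸-∸≡+-∸ (γ x) (m≤n⇒m≤1+n (height≤m x)) ⟩
        γ x + height x ∸ suc m ≤⟨ ∸-monoˡ-≤ (suc m) (γ+height-mono hyp1 γ-strict x≺y) ⟩
        γ y + height y ∸ suc m ≡⟨ ∸-∸≡+-∸ (γ y) (m≤n⇒m≤1+n (height≤m y)) ⟨
        γ y ∸ coheight y       ∎
        where open ≤-Reasoning

      minimal⇒≤label : Hyp1 _≤_ → ∀ {γ} → MinimalInIntCM _≤_ γ →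
                       ∀ {c} → IsChain _≤_ c → length c ≡ m → (i : Fin (length c)) →
                       γ (lookup c i) ≤ℕ suc (toℕ i)
      minimal⇒≤label hyp1 {γ} γ-minimal {c} ch refl i = begin
        γ (lookup c i)                     ≤⟨ γ≤coheight (lookup c i) ⟩
        suc m ∸ height (lookup c i)        ≤⟨ ∸-monoʳ-≤ (suc m) (lookup-height ch i) ⟩
        suc m ∸ (m ∸ toℕ i)                ≡⟨ +-∸-assoc 1 (m∸n≤m m (toℕ i)) ⟩
        suc (m ∸ (m ∸ toℕ i))              ≡⟨ cong suc (m∸[m∸n]≡n (<⇒≤ (Fin.toℕ<n i))) ⟩
        suc (toℕ i)                        ∎
        where
        open ≤-Reasoning
        γ≤coheight : ∀ x → γ x ≤ℕ coheight x
        γ≤coheight =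
          MinimalInIntCM⇒≤ γ-minimal coheight-InIntCM (γ∸coheight-mono hyp1 (proj₁ γ-minimal))

    Labelled : (Fin n → ℕ) → Set
    Labelled γ =
      ∀ c → IsChain _≤_ c → length c ≡ m → (i : Fin (length c)) → γ (lookup c i) ≡ suc (toℕ i)

    minimal⇒labelled : Hyp1 _≤_ → ∀ {γ} → MinimalInIntCM _≤_ γ → Labelled γ
    minimal⇒labelled hyp1 γ-minimal c ch len i =
      decidable-stable (_ ≟ _) λ ≢ → ¬¬-∀-Fin ¬¬-longest-AscFrom λ heights →
        ≢ (≤-antisym (Heights.minimal⇒≤label heights hyp1 γ-minimal ch len i)
                     (InIntCM⇒label≤ (proj₁ γ-minimal) ch i))

    longest-chain-top : Fin n → (∃ λ c → IsChain _≤_ c × length c ≡ m) →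
                        ∃ λ w → IsMaximal _≤_ w × IsMaxLength _≤_ (DescFrom _≤_ w) m
    longest-chain-top x₀ ([] , _ , refl) = ⊥-elim (1+n≰n (bounded [ x₀ ] [-]))
    longest-chain-top x₀ (w₀ ∷ c , ch , len) with last-∷ w₀ c
    ... | w , last≡w =
      w , last-isMaximal ch last≡w (λ y ch′ → subst (_ ≤ℕ_) (sym len) (bounded _ ch′)) ,
      ((w₀ ∷ c , (ch , last≡w) , len) , λ d desc → bounded d (proj₁ desc))

    module _ (hyp2 : Hyp2 _≤_)
             (top : ∃ λ w → IsMaximal _≤_ w × IsMaxLength _≤_ (DescFrom _≤_ w) m) where

      maximal⇒longest-DescFrom : ∀ {z k} → IsMaximal _≤_ z →
                                 IsMaxLength _≤_ (DescFrom _≤_ z) k → k ≡ m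
      maximal⇒longest-DescFrom {z} {k} z-maximal z-longest =
        hyp2 z (proj₁ top) k m z-maximal (proj₁ (proj₂ top)) z-longest (proj₂ (proj₂ top))

      ¬¬-longest-chain-above : ∀ x → ¬ ¬ ∃₂ λ z c → x ≤ z × DescFrom _≤_ z c × length c ≡ m
      ¬¬-longest-chain-above x ¬above = ¬¬-longest-AscFrom x λ
        { (_ ∷ t , (ch , refl) , longest-asc) →
          let z , last≡z = last-∷ x t
              z-maximal = last-isMaximal ch last≡z λ y ch′ → longest-asc _ (ch′ , refl)
          in ¬¬-longest m (λ d desc → bounded d (proj₁ desc)) {[ z ]} ([-] , refl)
               λ (d , desc , longest-desc) → ¬above (z , d , head≤last ch refl last≡z , desc ,
                 maximal⇒longest-DescFrom z-maximal ((d , desc , refl) , longest-desc)) }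

      labelled⇒minimal : ∀ {γ} → InIntCM _≤_ γ → Labelled γ → MinimalInIntCM _≤_ γ
      labelled⇒minimal {γ} γ-int labelled = γ-int , λ δ δ-int δ≤γ x →
        decidable-stable (_ ≟ _) λ ≢ →
          ¬¬-longest-chain-above x λ (z , c , x≤z , (ch , last≡z) , len) →
            ≢ (LeM-agrees-below δ≤γ x≤z (γ≤δ-at-last δ-int ch last≡z len))
        where
        γ≤δ-at-last : ∀ {δ} → InIntCM _≤_ δ → ∀ {c z} → IsChain _≤_ c → last c ≡ just z →
                      length c ≡ m → γ z ≤ℕ δ z
        γ≤δ-at-last δ-int {c} ch last≡z len with lookup-last c last≡z
        ... | i , refl = ≤-trans (≤-reflexive (labelled c ch len i)) (InIntCM⇒label≤ δ-int ch i)

proposition11 : (n : ℕ) → (_≤_ : Fin n → Fin n → Set) → IsPartialOrder _≡_ _≤_ → 0 < n →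
    Hyp1 _≤_ → Hyp2 _≤_ →
    (m : ℕ) → IsMaxLength _≤_ (IsChain _≤_) m →
    (γ : Fin n → ℕ) → InIntCM _≤_ γ →
    (MinimalInIntCM _≤_ γ ⇔
      (∀ c → IsChain _≤_ c → length c ≡ m → (i : Fin (length c)) → γ (lookup c i) ≡ suc (toℕ i)))
proposition11 (suc n) _≤_ isPartialOrder _ hyp1 hyp2 m (longest , bounded) γ γ-int =
  mk⇔ (minimal⇒labelled _≤_ isPartialOrder m bounded hyp1)
      (labelled⇒minimal _≤_ isPartialOrder m bounded hyp2
        (longest-chain-top _≤_ isPartialOrder m bounded fzero longest) γ-int)
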